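{- Let $p,q,m$ be positive integers with $p\ge 2$, $n=p+q+m$, and let $i$ be an integer with $1<i\le p$. Let $A=(C_p\oplus C_q\oplus C_m)+T(1,p+q,i,p+q+m)$. Then $A$ is permutation similar to an alternating sign matrix unless one of the following holds (in which case it is not): (i) $p=i=2$ and $1\in\{q,m\}$; (ii) $i=p$ and $q=m=1$; (iii) $i=2$ and $q=m=1$.
   Context: $C_k$ is the $k\times k$ permutation matrix with $1$ in positions $(i+1,i)$ for $1\le i\le k-1$ and in position $(1,k)$ ($C_1=(1)$); $\oplus$ denotes matrix direct sum. $T(i_1,j_1,i_2,j_2)$ (with $i_1\ne i_2$, $j_1\ne j_2$) is the $n\times n$ matrix with $1$ in positions $(i_1,j_1),(i_2,j_2)$, $-1$ in positions $(i_1,j_2),(i_2,j_1)$, $0$ elsewhere. An alternating sign matrix is a square $(0,1,-1)$-matrix in which the non-zero entries of each row and column alternate in sign, beginning and ending with $+1$. Matrices $A,B$ are permutation similar if $B=R^TAR$ for a permutation matrix $R$. -}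

module Defs where

open import Data.Nat using (ℕ; zero; suc; _+_)
open import Data.Integer as ℤ using (ℤ; +_; -[1+_])
open import Data.Fin using (Fin; toℕ; splitAt)
open import Data.Fin.Permutation using (Permutation′; _⟨$⟩ʳ_)
open import Data.List using (List; []; _∷_; tabulate)
open import Data.List.Relation.Unary.All using (All)
open import Data.Sum using (_⊎_; inj₁; inj₂)
open import Data.Product using (_×_; Σ)
open import Relation.Binary.PropositionalEquality using (_≡_)
open import Relation.Nullary using (yes; no)

Mat : ℕ → Set
Mat n = Fin n → Fin n → ℤ

δ : ℕ → ℕ → ℤ
δ a b with a Data.Nat.≟ b
... | yes _ = + 1
... | no  _ = + 0

-- C_k: 1 in positions (a+1,a), 1 ≤ a ≤ k-1, and in (1,k)  (1-based).
-- With 0-based r,c: 1 iff r = c+1, or (r = 0 and c = k-1).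
Cyc : (k : ℕ) → Mat k
Cyc k r c with toℕ r Data.Nat.≟ suc (toℕ c)
... | yes _ = + 1
... | no  _ = ℤ._*_ (δ (toℕ r) 0) (δ (suc (toℕ c)) k)

_⊕_ : ∀ {a b} → Mat a → Mat b → Mat (a + b)
_⊕_ {a} {b} X Y r c with splitAt a r | splitAt a c
... | inj₁ r′ | inj₁ c′ = X r′ c′
... | inj₂ r′ | inj₂ c′ = Y r′ c′
... | inj₁ _  | inj₂ _  = + 0
... | inj₂ _  | inj₁ _  = + 0

infixl 6 _⊕_

_+M_ : ∀ {n} → Mat n → Mat n → Mat n
(X +M Y) r c = X r c ℤ.+ Y r c

-- T(i1,j1,i2,j2) as an n×n matrix, with 1-based indices i1 j1 i2 j2.
-- Entry at 1-based (a,b): [a=i1][b=j1] + [a=i2][b=j2] - [a=i1][b=j2] - [a=i2][b=j1].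
T : (n i₁ j₁ i₂ j₂ : ℕ) → Mat n
T n i₁ j₁ i₂ j₂ r c =
  let a = suc (toℕ r) ; b = suc (toℕ c) in
  ((ℤ._*_ (δ a i₁) (δ b j₁) ℤ.+ ℤ._*_ (δ a i₂) (δ b j₂))
    ℤ.- ℤ._*_ (δ a i₁) (δ b j₂)) ℤ.- ℤ._*_ (δ a i₂) (δ b j₁)

sumL : List ℤ → ℤ
sumL [] = + 0
sumL (x ∷ xs) = x ℤ.+ sumL xs

_*M_ : ∀ {n} → Mat n → Mat n → Mat n
(X *M Y) r c = sumL (tabulate (λ k → X r k ℤ.* Y k c))

transpose : ∀ {n} → Mat n → Mat n
transpose X r c = X c r

permMatrix : ∀ {n} → Permutation′ n → Mat n
permMatrix π r c with toℕ r Data.Nat.≟ toℕ (π ⟨$⟩ʳ c)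
... | yes _ = + 1
... | no  _ = + 0

PermSimilar : ∀ {n} → Mat n → Mat n → Set
PermSimilar {n} A B =
  Σ (Permutation′ n) λ π → ∀ r c → B r c ≡ ((transpose (permMatrix π) *M A) *M permMatrix π) r c

data IsSign : ℤ → Set where
  zer : IsSign (+ 0)
  pos : IsSign (+ 1)
  neg : IsSign -[1+ 0 ]

nonzeros : List ℤ → List ℤ
nonzeros [] = []
nonzeros (+ zero ∷ xs) = nonzeros xs
nonzeros (x ∷ xs) = x ∷ nonzeros xs

data Alternating : List ℤ → Set where
  one  : Alternating (+ 1 ∷ [])
  step : ∀ {xs} → Alternating xs → Alternating (+ 1 ∷ -[1+ 0 ] ∷ xs)

row : ∀ {n} → Mat n → Fin n → List ℤ
row X r = tabulate (λ c → X r c)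

col : ∀ {n} → Mat n → Fin n → List ℤ
col X c = tabulate (λ r → X r c)

IsASM : ∀ {n} → Mat n → Set
IsASM X =
  (∀ r c → IsSign (X r c)) ×
  (∀ r → Alternating (nonzeros (row X r))) ×
  (∀ c → Alternating (nonzeros (col X c)))

PermSimilarToASM : ∀ {n} → Mat n → Set
PermSimilarToASM {n} A = Σ (Mat n) λ B → IsASM B × PermSimilar A B

Amat : (p q m i : ℕ) → Mat (p + q + m)
Amat p q m i = (Cyc p ⊕ Cyc q ⊕ Cyc m) +M T (p + q + m) 1 (p + q) i (p + q + m)

Exceptional : (p q m i : ℕ) → Set
Exceptional p q m i =
  (p ≡ 2 × i ≡ 2 × (q ≡ 1 ⊎ m ≡ 1)) ⊎
  (i ≡ p × q ≡ 1 × m ≡ 1) ⊎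
  (i ≡ 2 × q ≡ 1 × m ≡ 1)

module Submission where

open import Defs
open import Data.Nat using (ℕ; _≤_; _<_)
open import Data.Product using (_×_)
open import Relation.Nullary using (¬_)

open import Data.Bool using (Bool; true; false; _∧_; not)
import Data.Bool.Properties as Bool
open import Data.Empty using (⊥-elim)
open import Data.Fin as Fin using (Fin; zero; suc; toℕ; fromℕ<)
open import Data.Fin.Patterns using (0F; 1F; 2F; 3F)
open import Data.Fin.Permutation
  using (Permutation′; _⟨$⟩ʳ_; _⟨$⟩ˡ_; inverseˡ; inverseʳ; id; insert; insert-punchIn)
import Data.Fin.Properties as Fin
open import Data.Integer as ℤ using (ℤ; +_; -[1+_])
import Data.Integer.Properties as ℤ
open import Data.Integer.Solver using (module +-*-Solver)
open import Data.List using (List; []; _∷_; tabulate; map)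
import Data.List.Properties as List
open import Data.List.Relation.Unary.All using (All; []; _∷_)
open import Data.List.Relation.Unary.AllPairs as AllPairs using (AllPairs; []; _∷_)
import Data.List.Relation.Unary.AllPairs.Properties as AllPairs
open import Data.List.Relation.Unary.Any using (Any; here; there; any?)
open import Data.Nat as ℕ using (zero; suc; _+_; _∸_; z≤n; s≤s)
import Data.Nat.Properties as ℕ
open import Data.Product using (∃; ∃-syntax; _,_; proj₁; proj₂; uncurry)
import Data.Product.Properties as Product
open import Data.Sum using (_⊎_; inj₁; inj₂)
open import Data.Unit using (⊤; tt)
open import Function using (_∘_; _⇔_; mk⇔; Equivalence)
open import Relation.Binary.Definitions using (tri<; tri≈; tri>)
open import Relation.Binary.PropositionalEquality
open import Relation.Nullary using (yes; no; Dec; ¬?)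
open import Relation.Nullary.Decidable using (_×-dec_; _⊎-dec_; map′; True; toWitness)

-- Conjugating A by a permutation matrix gives again a permutation matrix plus the block
-- [[1,−1],[−1,1]] in rows 1, i and columns p + q, n, each of these four lines carrying one more
-- entry 1; every other line is a unit vector.  So the conjugate is an alternating sign matrix
-- exactly when in each of the four lines the −1 lies between the two 1's, i.e. when the new
-- positions of the columns p, n, p + q, i − 1 and of the rows p + 1, i, 1, p + q + 1 are
-- monotone.  These indices form four blocks 1 ≤ i − 1 < i ≤ p < p + 1 ≤ p + q < p + q + 1 ≤ n,
-- whose two members coincide when i = 2, i = p, q = 1, m = 1 respectively.  If at most two
-- blocks collapse an explicit order works; if three collapse, the two monotone quadruples
-- would have different middle elements among the same three positions.

private
  variable
    n : ℕ


-- Alternating vectors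

nonzeros-≢0 : ∀ {x} xs → x ≢ + 0 → nonzeros (x ∷ xs) ≡ x ∷ nonzeros xs
nonzeros-≢0 {+ zero}    _ x≢0 = ⊥-elim (x≢0 refl)
nonzeros-≢0 {+ suc _}   _ _   = refl
nonzeros-≢0 { -[1+ _ ]} _ _   = refl

nonzeros-≡0 : ∀ {x} xs → x ≡ + 0 → nonzeros (x ∷ xs) ≡ nonzeros xs
nonzeros-≡0 _ refl = refl

≢-suc : {y u : Fin n} → y ≢ u → suc y ≢ suc u
≢-suc y≢u = y≢u ∘ Fin.suc-injective

nonzeros-tabulate₀ : (g : Fin n → ℤ) → (∀ y → g y ≡ + 0) → nonzeros (tabulate g) ≡ []
nonzeros-tabulate₀ {zero}  g g≡0 = refl
nonzeros-tabulate₀ {suc n} g g≡0 =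
  trans (nonzeros-≡0 _ (g≡0 zero)) (nonzeros-tabulate₀ (g ∘ suc) (g≡0 ∘ suc))

nonzeros-tabulate₁ : (g : Fin n → ℤ) (u : Fin n) → g u ≢ + 0 →
                     (∀ y → y ≢ u → g y ≡ + 0) → nonzeros (tabulate g) ≡ g u ∷ []
nonzeros-tabulate₁ g zero gu≢0 g≡0 =
  trans (nonzeros-≢0 _ gu≢0)
        (cong (g zero ∷_) (nonzeros-tabulate₀ (g ∘ suc) (λ y → g≡0 (suc y) λ ())))
nonzeros-tabulate₁ g (suc u) gu≢0 g≡0 =
  trans (nonzeros-≡0 _ (g≡0 zero λ ()))
        (nonzeros-tabulate₁ (g ∘ suc) u gu≢0 (λ y → g≡0 (suc y) ∘ ≢-suc))

nonzeros-tabulate₂ : (g : Fin n → ℤ) (u v : Fin n) → toℕ u < toℕ v → g u ≢ + 0 → g v ≢ + 0 →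
                     (∀ y → y ≢ u → y ≢ v → g y ≡ + 0) → nonzeros (tabulate g) ≡ g u ∷ g v ∷ []
nonzeros-tabulate₂ g zero (suc v) _ gu≢0 gv≢0 g≡0 =
  trans (nonzeros-≢0 _ gu≢0)
        (cong (g zero ∷_) (nonzeros-tabulate₁ (g ∘ suc) v gv≢0 (λ y → g≡0 (suc y) (λ ()) ∘ ≢-suc)))
nonzeros-tabulate₂ g (suc u) (suc v) (s≤s u<v) gu≢0 gv≢0 g≡0 =
  trans (nonzeros-≡0 _ (g≡0 zero (λ ()) (λ ())))
        (nonzeros-tabulate₂ (g ∘ suc) u v u<v gu≢0 gv≢0 (λ y y≢u y≢v → g≡0 (suc y) (≢-suc y≢u) (≢-suc y≢v)))

nonzeros-tabulate₃ : (g : Fin n → ℤ) (u v w : Fin n) → toℕ u < toℕ v → toℕ v < toℕ w →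
                     g u ≢ + 0 → g v ≢ + 0 → g w ≢ + 0 →
                     (∀ y → y ≢ u → y ≢ v → y ≢ w → g y ≡ + 0) →
                     nonzeros (tabulate g) ≡ g u ∷ g v ∷ g w ∷ []
nonzeros-tabulate₃ g zero (suc v) (suc w) _ (s≤s v<w) gu≢0 gv≢0 gw≢0 g≡0 =
  trans (nonzeros-≢0 _ gu≢0)
        (cong (g zero ∷_) (nonzeros-tabulate₂ (g ∘ suc) v w v<w gv≢0 gw≢0
          (λ y y≢v y≢w → g≡0 (suc y) (λ ()) (≢-suc y≢v) (≢-suc y≢w))))
nonzeros-tabulate₃ g (suc u) (suc v) (suc w) (s≤s u<v) (s≤s v<w) gu≢0 gv≢0 gw≢0 g≡0 =
  trans (nonzeros-≡0 _ (g≡0 zero (λ ()) (λ ()) (λ ())))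
        (nonzeros-tabulate₃ (g ∘ suc) u v w u<v v<w gu≢0 gv≢0 gw≢0
          (λ y y≢u y≢v y≢w → g≡0 (suc y) (≢-suc y≢u) (≢-suc y≢v) (≢-suc y≢w)))

alternating₃-middle : ∀ {a b c} → Alternating (a ∷ b ∷ c ∷ []) → b ≡ -[1+ 0 ]
alternating₃-middle (step one) = refl

alternating-middle : (g : Fin n → ℤ) {x y z : Fin n} → Alternating (nonzeros (tabulate g)) →
                     toℕ x < toℕ y → toℕ y < toℕ z → g x ≢ + 0 → g y ≢ + 0 → g z ≢ + 0 →
                     (∀ t → t ≢ x → t ≢ y → t ≢ z → g t ≡ + 0) → g y ≡ -[1+ 0 ]
alternating-middle g alt x<y y<z gx≢0 gy≢0 gz≢0 g≡0 =
  alternating₃-middle (subst Alternating (nonzeros-tabulate₃ g _ _ _ x<y y<z gx≢0 gy≢0 gz≢0 g≡0) alt)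

UnitAt : (Fin n → ℤ) → Fin n → Set
UnitAt g u = g u ≡ + 1 × (∀ y → y ≢ u → g y ≡ + 0)

record PlusMinusPlus (g : Fin n → ℤ) (u v w : Fin n) : Set where
  field
    at-u    : g u ≡ + 1
    at-v    : g v ≡ -[1+ 0 ]
    at-w    : g w ≡ + 1
    u≢w     : u ≢ w
    zero-at : ∀ y → y ≢ u → y ≢ v → y ≢ w → g y ≡ + 0

Between : ℕ → ℕ → ℕ → Set
Between a m b = (a < m × m < b) ⊎ (b < m × m < a)

≡+1⇒≢0 : ∀ {x} → x ≡ + 1 → x ≢ + 0
≡+1⇒≢0 refl ()

≡-1⇒≢0 : ∀ {x} → x ≡ -[1+ 0 ] → x ≢ + 0
≡-1⇒≢0 refl ()

+1≢-1 : ∀ {x} → x ≡ + 1 → x ≢ -[1+ 0 ]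
+1≢-1 refl ()

alternating-unitAt : {g : Fin n → ℤ} {u : Fin n} → UnitAt g u → Alternating (nonzeros (tabulate g))
alternating-unitAt {g = g} {u} (gu , g≡0) =
  subst Alternating (sym (trans (nonzeros-tabulate₁ g u (≡+1⇒≢0 gu) g≡0) (cong (_∷ []) gu))) one

module _ {g : Fin n → ℤ} {u v w : Fin n} (pmp : PlusMinusPlus g u v w) where
  open PlusMinusPlus pmp renaming (at-u to gu; at-v to gv; at-w to gw; zero-at to g≡0)

  alternating-plusMinusPlus : Between (toℕ u) (toℕ v) (toℕ w) → Alternating (nonzeros (tabulate g))
  alternating-plusMinusPlus (inj₁ (u<v , v<w)) =
    subst Alternating
      (sym (trans (nonzeros-tabulate₃ g u v w u<v v<w (≡+1⇒≢0 gu) (≡-1⇒≢0 gv) (≡+1⇒≢0 gw) g≡0)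
                  (cong₂ _∷_ gu (cong₂ _∷_ gv (cong (_∷ []) gw)))))
      (step one)
  alternating-plusMinusPlus (inj₂ (w<v , v<u)) =
    subst Alternating
      (sym (trans (nonzeros-tabulate₃ g w v u w<v v<u (≡+1⇒≢0 gw) (≡-1⇒≢0 gv) (≡+1⇒≢0 gu)
                     (λ y y≢w y≢v y≢u → g≡0 y y≢u y≢v y≢w))
                  (cong₂ _∷_ gw (cong₂ _∷_ gv (cong (_∷ []) gu)))))
      (step one)

  plusMinusPlus-between : Alternating (nonzeros (tabulate g)) → Between (toℕ u) (toℕ v) (toℕ w)
  plusMinusPlus-between alt with ℕ.<-cmp (toℕ u) (toℕ v) | ℕ.<-cmp (toℕ v) (toℕ w)
  ... | tri< u<v _ _ | tri< v<w _ _ = inj₁ (u<v , v<w)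
  ... | tri> _ _ v<u | tri> _ _ w<v = inj₂ (w<v , v<u)
  ... | tri≈ _ u≡v _ | _ = ⊥-elim (+1≢-1 gu (subst (λ y → g y ≡ -[1+ 0 ]) (sym (Fin.toℕ-injective u≡v)) gv))
  ... | _ | tri≈ _ v≡w _ = ⊥-elim (+1≢-1 gw (subst (λ y → g y ≡ -[1+ 0 ]) (Fin.toℕ-injective v≡w) gv))
  ... | tri< u<v _ _ | tri> _ _ w<v with ℕ.<-cmp (toℕ u) (toℕ w)
  ...   | tri< u<w _ _ = ⊥-elim (+1≢-1 gw (alternating-middle g alt u<w w<v (≡+1⇒≢0 gu) (≡+1⇒≢0 gw) (≡-1⇒≢0 gv)
                                             (λ y y≢u y≢w y≢v → g≡0 y y≢u y≢v y≢w)))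
  ...   | tri≈ _ u≡w _ = ⊥-elim (u≢w (Fin.toℕ-injective u≡w))
  ...   | tri> _ _ w<u = ⊥-elim (+1≢-1 gu (alternating-middle g alt w<u u<v (≡+1⇒≢0 gw) (≡+1⇒≢0 gu) (≡-1⇒≢0 gv)
                                             (λ y y≢w y≢u y≢v → g≡0 y y≢u y≢v y≢w)))
  plusMinusPlus-between alt | tri> _ _ v<u | tri< v<w _ _ with ℕ.<-cmp (toℕ u) (toℕ w)
  ...   | tri< u<w _ _ = ⊥-elim (+1≢-1 gu (alternating-middle g alt v<u u<w (≡-1⇒≢0 gv) (≡+1⇒≢0 gu) (≡+1⇒≢0 gw)
                                             (λ y y≢v y≢u y≢w → g≡0 y y≢u y≢v y≢w)))
  ...   | tri≈ _ u≡w _ = ⊥-elim (u≢w (Fin.toℕ-injective u≡w))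
  ...   | tri> _ _ w<u = ⊥-elim (+1≢-1 gw (alternating-middle g alt v<w w<u (≡-1⇒≢0 gv) (≡+1⇒≢0 gw) (≡+1⇒≢0 gu)
                                             (λ y y≢v y≢w y≢u → g≡0 y y≢u y≢v y≢w)))

plusMinusPlus-signs : {g : Fin n → ℤ} {u v w : Fin n} → PlusMinusPlus g u v w → ∀ y → IsSign (g y)
plusMinusPlus-signs {u = u} {v} {w} pmp y with y Fin.≟ u | y Fin.≟ v | y Fin.≟ w
... | yes refl | _        | _        = subst IsSign (sym (PlusMinusPlus.at-u pmp)) pos
... | no _     | yes refl | _        = subst IsSign (sym (PlusMinusPlus.at-v pmp)) neg
... | no _     | no _     | yes refl = subst IsSign (sym (PlusMinusPlus.at-w pmp)) pos
... | no y≢u   | no y≢v   | no y≢w   = subst IsSign (sym (PlusMinusPlus.zero-at pmp y y≢u y≢v y≢w)) zer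

unitAt-signs : {g : Fin n → ℤ} {u : Fin n} → UnitAt g u → ∀ y → IsSign (g y)
unitAt-signs {u = u} (gu , g≡0) y with y Fin.≟ u
... | yes refl = subst IsSign (sym gu) pos
... | no y≢u   = subst IsSign (sym (g≡0 y y≢u)) zer


-- Conjugation by permutation matrices

sumL-tabulate-0 : {h : Fin n → ℤ} → (∀ k → h k ≡ + 0) → sumL (tabulate h) ≡ + 0
sumL-tabulate-0 {zero}  h≡0 = refl
sumL-tabulate-0 {suc n} h≡0 = cong₂ ℤ._+_ (h≡0 zero) (sumL-tabulate-0 (h≡0 ∘ suc))

sumL-unitAt : {e : Fin n → ℤ} {j : Fin n} → UnitAt e j → (f : Fin n → ℤ) →
              sumL (tabulate (λ k → e k ℤ.* f k)) ≡ f j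
sumL-unitAt {suc n} {e = e} {zero} (e₀ , e≡0) f = begin
  e zero ℤ.* f zero ℤ.+ sumL (tabulate (λ k → e (suc k) ℤ.* f (suc k)))
    ≡⟨ cong₂ (λ a b → a ℤ.* f zero ℤ.+ b) e₀
             (sumL-tabulate-0 (λ k → trans (cong (ℤ._* f (suc k)) (e≡0 (suc k) λ ())) (ℤ.*-zeroˡ (f (suc k))))) ⟩
  + 1 ℤ.* f zero ℤ.+ + 0
    ≡⟨ trans (ℤ.+-identityʳ _) (ℤ.*-identityˡ _) ⟩
  f zero ∎
  where open ≡-Reasoning
sumL-unitAt {suc n} {e = e} {suc j} (ej , e≡0) f = begin
  e zero ℤ.* f zero ℤ.+ sumL (tabulate (λ k → e (suc k) ℤ.* f (suc k)))
    ≡⟨ cong (ℤ._+ sumL (tabulate (λ k → e (suc k) ℤ.* f (suc k))))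
            (trans (cong (ℤ._* f zero) (e≡0 zero λ ())) (ℤ.*-zeroˡ (f zero))) ⟩
  + 0 ℤ.+ sumL (tabulate (λ k → e (suc k) ℤ.* f (suc k)))
    ≡⟨ ℤ.+-identityˡ _ ⟩
  sumL (tabulate (λ k → e (suc k) ℤ.* f (suc k)))
    ≡⟨ sumL-unitAt (ej , λ y y≢j → e≡0 (suc y) (≢-suc y≢j)) (f ∘ suc) ⟩
  f (suc j) ∎
  where open ≡-Reasoning

permMatrix-unitAt : (π : Permutation′ n) (c : Fin n) → UnitAt (λ r → permMatrix π r c) (π ⟨$⟩ʳ c)
permMatrix-unitAt π c = entry-at , entry-off
  where
  entry-at : permMatrix π (π ⟨$⟩ʳ c) c ≡ + 1
  entry-at with toℕ (π ⟨$⟩ʳ c) ℕ.≟ toℕ (π ⟨$⟩ʳ c)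
  ... | yes _ = refl
  ... | no ne = ⊥-elim (ne refl)
  entry-off : ∀ r → r ≢ π ⟨$⟩ʳ c → permMatrix π r c ≡ + 0
  entry-off r r≢πc with toℕ r ℕ.≟ toℕ (π ⟨$⟩ʳ c)
  ... | yes eq = ⊥-elim (r≢πc (Fin.toℕ-injective eq))
  ... | no _   = refl

conjugate-permMatrix : (π : Permutation′ n) (A : Mat n) (r c : Fin n) →
                       ((transpose (permMatrix π) *M A) *M permMatrix π) r c ≡ A (π ⟨$⟩ʳ r) (π ⟨$⟩ʳ c)
conjugate-permMatrix π A r c = begin
  sumL (tabulate (λ k → (transpose (permMatrix π) *M A) r k ℤ.* permMatrix π k c))
    ≡⟨ cong sumL (List.tabulate-cong (λ k → ℤ.*-comm _ (permMatrix π k c))) ⟩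
  sumL (tabulate (λ k → permMatrix π k c ℤ.* (transpose (permMatrix π) *M A) r k))
    ≡⟨ sumL-unitAt (permMatrix-unitAt π c) _ ⟩
  sumL (tabulate (λ k → permMatrix π k r ℤ.* A k (π ⟨$⟩ʳ c)))
    ≡⟨ sumL-unitAt (permMatrix-unitAt π r) _ ⟩
  A (π ⟨$⟩ʳ r) (π ⟨$⟩ʳ c) ∎
  where open ≡-Reasoning

module _ (π : Permutation′ n) where
  private
    ≢-π : ∀ {y u} → y ≢ π ⟨$⟩ˡ u → π ⟨$⟩ʳ y ≢ u
    ≢-π y≢ρu πy≡u = y≢ρu (trans (sym (inverseˡ π)) (cong (π ⟨$⟩ˡ_) πy≡u))

    at-ρ : (h : Fin n → ℤ) {u : Fin n} {x : ℤ} → h u ≡ x → h (π ⟨$⟩ʳ (π ⟨$⟩ˡ u)) ≡ x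
    at-ρ h hu = trans (cong h (inverseʳ π)) hu

  unitAt-permute : {h : Fin n → ℤ} {u : Fin n} → UnitAt h u → UnitAt (h ∘ (π ⟨$⟩ʳ_)) (π ⟨$⟩ˡ u)
  unitAt-permute {h} (hu , h≡0) = at-ρ h hu , λ y y≢ρu → h≡0 _ (≢-π y≢ρu)

  plusMinusPlus-permute : {h : Fin n → ℤ} {u v w : Fin n} → PlusMinusPlus h u v w →
                          PlusMinusPlus (h ∘ (π ⟨$⟩ʳ_)) (π ⟨$⟩ˡ u) (π ⟨$⟩ˡ v) (π ⟨$⟩ˡ w)
  plusMinusPlus-permute {h} pmp = record
    { at-u    = at-ρ h at-u
    ; at-v    = at-ρ h at-v
    ; at-w    = at-ρ h at-w
    ; u≢w     = λ ρu≡ρw → u≢w (trans (sym (inverseʳ π)) (trans (cong (π ⟨$⟩ʳ_) ρu≡ρw) (inverseʳ π)))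
    ; zero-at = λ y y≢ρu y≢ρv y≢ρw → zero-at _ (≢-π y≢ρu) (≢-π y≢ρv) (≢-π y≢ρw)
    }
    where open PlusMinusPlus pmp


Monotone₄ : ℕ → ℕ → ℕ → ℕ → Set
Monotone₄ a b c d = (a < b × b < c × c < d) ⊎ (d < c × c < b × b < a)

between-sym : ∀ {a m b} → Between a m b → Between b m a
between-sym (inj₁ (a<m , m<b)) = inj₂ (a<m , m<b)
between-sym (inj₂ (b<m , m<a)) = inj₁ (b<m , m<a)

between-unique : ∀ {a m b} → Between a m b → ¬ Between m a b
between-unique (inj₁ (a<m , _))   (inj₁ (m<a , _)) = ℕ.<-asym a<m m<a
between-unique (inj₁ (_ , m<b))   (inj₂ (b<a , a<m)) = ℕ.<-asym m<b (ℕ.<-trans b<a a<m)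
between-unique (inj₂ (b<m , m<a)) (inj₁ (_ , a<b))   = ℕ.<-asym m<a (ℕ.<-trans a<b b<m)
between-unique (inj₂ (_ , m<a))   (inj₂ (_ , a<m)) = ℕ.<-asym m<a a<m

between⇒monotone₄ : ∀ {a b c d} → Between a b c → Between b c d → Monotone₄ a b c d
between⇒monotone₄ (inj₁ (a<b , b<c)) (inj₁ (_ , c<d))   = inj₁ (a<b , b<c , c<d)
between⇒monotone₄ (inj₁ (_ , b<c))   (inj₂ (_ , c<b))   = ⊥-elim (ℕ.<-asym b<c c<b)
between⇒monotone₄ (inj₂ (c<b , _))   (inj₁ (b<c , _))   = ⊥-elim (ℕ.<-asym b<c c<b)
between⇒monotone₄ (inj₂ (c<b , b<a)) (inj₂ (d<c , _))   = inj₂ (d<c , c<b , b<a)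

module _ {a b c d : ℕ} where
  monotone₄-between₁₂₃ : Monotone₄ a b c d → Between a b c
  monotone₄-between₁₂₃ (inj₁ (a<b , b<c , _)) = inj₁ (a<b , b<c)
  monotone₄-between₁₂₃ (inj₂ (_ , c<b , b<a)) = inj₂ (c<b , b<a)

  monotone₄-between₁₂₄ : Monotone₄ a b c d → Between a b d
  monotone₄-between₁₂₄ (inj₁ (a<b , b<c , c<d)) = inj₁ (a<b , ℕ.<-trans b<c c<d)
  monotone₄-between₁₂₄ (inj₂ (d<c , c<b , b<a)) = inj₂ (ℕ.<-trans d<c c<b , b<a)

  monotone₄-between₁₃₄ : Monotone₄ a b c d → Between a c d
  monotone₄-between₁₃₄ (inj₁ (a<b , b<c , c<d)) = inj₁ (ℕ.<-trans a<b b<c , c<d)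
  monotone₄-between₁₃₄ (inj₂ (d<c , c<b , b<a)) = inj₂ (d<c , ℕ.<-trans c<b b<a)

  monotone₄-between₂₃₄ : Monotone₄ a b c d → Between b c d
  monotone₄-between₂₃₄ (inj₁ (_ , b<c , c<d)) = inj₁ (b<c , c<d)
  monotone₄-between₂₃₄ (inj₂ (d<c , c<b , _)) = inj₂ (d<c , c<b)

-- Three blocks of positions, each collapsed to one point, admit no monotone arrangement:
-- the two quadruples would have different middle points among the same three positions.
¬monotone₄-012 : ∀ {a₀ a₁ a₂ x y} → Monotone₄ a₁ x a₂ a₀ → ¬ Monotone₄ a₂ a₁ a₀ y
¬monotone₄-012 cols rows = between-unique (monotone₄-between₁₃₄ cols) (monotone₄-between₁₂₃ rows)

¬monotone₄-013 : ∀ {a₀ a₁ a₃ x y} → Monotone₄ a₁ a₃ x a₀ → ¬ Monotone₄ y a₁ a₀ a₃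
¬monotone₄-013 cols rows =
  between-unique (between-sym (monotone₄-between₁₂₄ cols)) (between-sym (monotone₄-between₂₃₄ rows))

¬monotone₄-123 : ∀ {a₁ a₂ a₃ x y} → Monotone₄ a₁ a₃ a₂ x → ¬ Monotone₄ a₂ a₁ y a₃
¬monotone₄-123 cols rows = between-unique (monotone₄-between₁₂₃ cols) (between-sym (monotone₄-between₁₂₄ rows))

¬monotone₄-023 : ∀ {a₀ a₂ a₃ x y} → Monotone₄ x a₃ a₂ a₀ → ¬ Monotone₄ a₂ y a₀ a₃
¬monotone₄-023 cols rows = between-unique (between-sym (monotone₄-between₂₃₄ cols)) (monotone₄-between₁₃₄ rows)


-- Permutation matrices perturbed by a cross

-- Rows r₁ r₂ and columns c₁ c₂ meet in the block [[1,−1],[−1,1]]; each of these four lines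
-- has one further entry +1, and every other line is a unit vector.
record CrossPattern (A : Mat n) : Set where
  field
    r₁ r₂ c₁ c₂ u₁ u₂ v₁ v₂ : Fin n
    row₁ : PlusMinusPlus (A r₁) u₁ c₂ c₁
    row₂ : PlusMinusPlus (A r₂) u₂ c₁ c₂
    col₁ : PlusMinusPlus (λ x → A x c₁) r₁ r₂ v₁
    col₂ : PlusMinusPlus (λ x → A x c₂) r₂ r₁ v₂
    otherRow : ∀ x → x ≢ r₁ → x ≢ r₂ → ∃ (UnitAt (A x))
    otherCol : ∀ y → y ≢ c₁ → y ≢ c₂ → ∃ (UnitAt (λ x → A x y))

-- Equivalently: after conjugation by π the −1 of each line of the cross lies between its two 1's.
Arranged : {A : Mat n} → CrossPattern A → Permutation′ n → Set
Arranged S π = Monotone₄ (ρ u₁) (ρ c₂) (ρ c₁) (ρ u₂) × Monotone₄ (ρ v₁) (ρ r₂) (ρ r₁) (ρ v₂)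
  where
  open CrossPattern S
  ρ : Fin _ → ℕ
  ρ x = toℕ (π ⟨$⟩ˡ x)

module _ {A : Mat n} (S : CrossPattern A) where
  open CrossPattern S

  crossPattern-signs : ∀ x y → IsSign (A x y)
  crossPattern-signs x with x Fin.≟ r₁ | x Fin.≟ r₂
  ... | yes refl | _        = plusMinusPlus-signs row₁
  ... | no _     | yes refl = plusMinusPlus-signs row₂
  ... | no x≢r₁  | no x≢r₂  = unitAt-signs (proj₂ (otherRow x x≢r₁ x≢r₂))

  module _ (π : Permutation′ n) where
    arranged-rows-alternate : Arranged S π → ∀ x → Alternating (nonzeros (tabulate (A x ∘ (π ⟨$⟩ʳ_))))
    arranged-rows-alternate (cols , _) x with x Fin.≟ r₁ | x Fin.≟ r₂
    ... | yes refl | _        =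
      alternating-plusMinusPlus (plusMinusPlus-permute π row₁) (monotone₄-between₁₂₃ cols)
    ... | no _     | yes refl =
      alternating-plusMinusPlus (plusMinusPlus-permute π row₂) (between-sym (monotone₄-between₂₃₄ cols))
    ... | no x≢r₁  | no x≢r₂  = alternating-unitAt (unitAt-permute π (proj₂ (otherRow x x≢r₁ x≢r₂)))

    arranged-cols-alternate : Arranged S π → ∀ y → Alternating (nonzeros (tabulate ((λ x → A x y) ∘ (π ⟨$⟩ʳ_))))
    arranged-cols-alternate (_ , rows) y with y Fin.≟ c₁ | y Fin.≟ c₂
    ... | yes refl | _        =
      alternating-plusMinusPlus (plusMinusPlus-permute π col₁) (between-sym (monotone₄-between₁₂₃ rows))
    ... | no _     | yes refl =
      alternating-plusMinusPlus (plusMinusPlus-permute π col₂) (monotone₄-between₂₃₄ rows)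
    ... | no y≢c₁  | no y≢c₂  = alternating-unitAt (unitAt-permute π (proj₂ (otherCol y y≢c₁ y≢c₂)))

    alternating-arranged : (∀ x → Alternating (nonzeros (tabulate (A x ∘ (π ⟨$⟩ʳ_))))) →
                           (∀ y → Alternating (nonzeros (tabulate ((λ x → A x y) ∘ (π ⟨$⟩ʳ_))))) →
                           Arranged S π
    alternating-arranged rows cols =
      between⇒monotone₄ (plusMinusPlus-between (plusMinusPlus-permute π row₁) (rows r₁))
                        (between-sym (plusMinusPlus-between (plusMinusPlus-permute π row₂) (rows r₂))) ,
      between⇒monotone₄ (between-sym (plusMinusPlus-between (plusMinusPlus-permute π col₁) (cols c₁)))
                        (plusMinusPlus-between (plusMinusPlus-permute π col₂) (cols c₂))

  permSimilarToASM⇔arranged : PermSimilarToASM A ⇔ ∃ (Arranged S)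
  permSimilarToASM⇔arranged = mk⇔ to from
    where
    to : PermSimilarToASM A → ∃ (Arranged S)
    to (B , (_ , rowsB , colsB) , π , B≡) =
      π , alternating-arranged π
            (λ x → subst (Alternating ∘ nonzeros) (List.tabulate-cong (row-entry x)) (rowsB (π ⟨$⟩ˡ x)))
            (λ y → subst (Alternating ∘ nonzeros) (List.tabulate-cong (λ r → col-entry r y)) (colsB (π ⟨$⟩ˡ y)))
      where
      B≡A : ∀ r c → B r c ≡ A (π ⟨$⟩ʳ r) (π ⟨$⟩ʳ c)
      B≡A r c = trans (B≡ r c) (conjugate-permMatrix π A r c)
      row-entry : ∀ x c → B (π ⟨$⟩ˡ x) c ≡ A x (π ⟨$⟩ʳ c)
      row-entry x c = trans (B≡A _ c) (cong (λ z → A z (π ⟨$⟩ʳ c)) (inverseʳ π))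
      col-entry : ∀ r y → B r (π ⟨$⟩ˡ y) ≡ A (π ⟨$⟩ʳ r) y
      col-entry r y = trans (B≡A r _) (cong (A (π ⟨$⟩ʳ r)) (inverseʳ π))
    from : ∃ (Arranged S) → PermSimilarToASM A
    from (π , arr) =
      B , (signs , arranged-rows-alternate π arr ∘ (π ⟨$⟩ʳ_) , cols) ,
      π , λ r c → sym (conjugate-permMatrix π A r c)
      where
      B : Mat n
      B r c = A (π ⟨$⟩ʳ r) (π ⟨$⟩ʳ c)
      signs : ∀ r c → IsSign (B r c)
      signs r c = crossPattern-signs _ _
      cols : ∀ c → Alternating (nonzeros (col B c))
      cols c = arranged-cols-alternate π arr (π ⟨$⟩ʳ c)


-- Permutations with a prescribed beginning

PlacedFrom : ℕ → Permutation′ n → List (Fin n) → Set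
PlacedFrom k π []       = ⊤
PlacedFrom k π (v ∷ vs) = toℕ (π ⟨$⟩ˡ v) ≡ k × PlacedFrom (suc k) π vs

module _ {v : Fin (suc n)} where
  punchOuts : {ws : List (Fin (suc n))} → All (v ≢_) ws → List (Fin n)
  punchOuts []           = []
  punchOuts (v≢w ∷ v≢ws) = Fin.punchOut v≢w ∷ punchOuts v≢ws

  punchOuts-≢ : {w : Fin (suc n)} {ws : List (Fin (suc n))} (v≢w : v ≢ w) (v≢ws : All (v ≢_) ws) →
                All (w ≢_) ws → All (Fin.punchOut v≢w ≢_) (punchOuts v≢ws)
  punchOuts-≢ v≢w []           []           = []
  punchOuts-≢ v≢w (v≢x ∷ v≢ws) (w≢x ∷ w≢ws) =
    (w≢x ∘ Fin.punchOut-injective v≢w v≢x) ∷ punchOuts-≢ v≢w v≢ws w≢ws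

  punchOuts-distinct : {ws : List (Fin (suc n))} (v≢ws : All (v ≢_) ws) →
                       AllPairs _≢_ ws → AllPairs _≢_ (punchOuts v≢ws)
  punchOuts-distinct []           []                  = []
  punchOuts-distinct (v≢w ∷ v≢ws) (w≢ws ∷ ws-distinct) =
    punchOuts-≢ v≢w v≢ws w≢ws ∷ punchOuts-distinct v≢ws ws-distinct

  module _ (σ : Permutation′ n) where
    insert-⟨$⟩ˡ-punchIn : ∀ x → insert zero v σ ⟨$⟩ˡ Fin.punchIn v x ≡ suc (σ ⟨$⟩ˡ x)
    insert-⟨$⟩ˡ-punchIn x = begin
      π ⟨$⟩ˡ Fin.punchIn v x
        ≡⟨ cong (π ⟨$⟩ˡ_) (sym (trans (insert-punchIn zero v σ (σ ⟨$⟩ˡ x)) (cong (Fin.punchIn v) (inverseʳ σ)))) ⟩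
      π ⟨$⟩ˡ (π ⟨$⟩ʳ suc (σ ⟨$⟩ˡ x))
        ≡⟨ inverseˡ π ⟩
      suc (σ ⟨$⟩ˡ x) ∎
      where
      open ≡-Reasoning
      π : Permutation′ (suc n)
      π = insert zero v σ

    placed-punchOuts : ∀ {k} {ws : List (Fin (suc n))} (v≢ws : All (v ≢_) ws) →
                       PlacedFrom k σ (punchOuts v≢ws) → PlacedFrom (suc k) (insert zero v σ) ws
    placed-punchOuts []           _                = tt
    placed-punchOuts (v≢w ∷ v≢ws) (σw≡k , placed) =
      trans (cong (toℕ ∘ (insert zero v σ ⟨$⟩ˡ_)) (sym (Fin.punchIn-punchOut v≢w)))
            (trans (cong toℕ (insert-⟨$⟩ˡ-punchIn _)) (cong suc σw≡k)) ,
      placed-punchOuts v≢ws placed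

enumerate : (vs : List (Fin n)) → AllPairs _≢_ vs → ∃[ π ] PlacedFrom 0 π vs
enumerate []               _                 = id , tt
enumerate {suc n} (v ∷ ws) (v≢ws ∷ distinct)
  with enumerate (punchOuts v≢ws) (punchOuts-distinct v≢ws distinct)
... | σ , placed =
  insert zero v σ , cong toℕ (inverseˡ (insert zero v σ) {zero}) , placed-punchOuts σ v≢ws placed


-- Chains of eight points

Label : Set
Label = Fin 4 × Bool

-- The representative of a label when the blocks marked by z are collapsed to a single point.
rep : (Fin 4 → Bool) → Label → Label
rep z (j , s) = j , not (z j) ∧ s

record Chain (n : ℕ) : Set where
  field
    point  : Label → Fin n
    gap    : Fin 4 → ℕ
    within : ∀ j → toℕ (point (j , true)) ≡ toℕ (point (j , false)) + gap j
    across : ∀ (j : Fin 3) → toℕ (point (Fin.inject₁ j , true)) < toℕ (point (suc j , false))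

  collapsed : Fin 4 → Bool
  collapsed j = gap j ℕ.≡ᵇ 0

  point-≤-true : ∀ j s → toℕ (point (j , s)) ≤ toℕ (point (j , true))
  point-≤-true j false = subst (toℕ (point (j , false)) ≤_) (sym (within j)) (ℕ.m≤m+n _ _)
  point-≤-true j true  = ℕ.≤-refl

  false-≤-point : ∀ j s → toℕ (point (j , false)) ≤ toℕ (point (j , s))
  false-≤-point j false = ℕ.≤-refl
  false-≤-point j true  = subst (toℕ (point (j , false)) ≤_) (sym (within j)) (ℕ.m≤m+n _ _)

  point-<-next : ∀ (j : Fin 3) s s′ → toℕ (point (Fin.inject₁ j , s)) < toℕ (point (suc j , s′))
  point-<-next j s s′ = ℕ.≤-<-trans (point-≤-true _ s) (ℕ.<-≤-trans (across j) (false-≤-point _ s′))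

  point-< : ∀ {j j′} s s′ → j Fin.< j′ → toℕ (point (j , s)) < toℕ (point (j′ , s′))
  point-< {0F} {1F} s s′ _ = point-<-next 0F s s′
  point-< {0F} {2F} s s′ _ = ℕ.<-trans (point-<-next 0F s true) (point-<-next 1F true s′)
  point-< {0F} {3F} s s′ _ =
    ℕ.<-trans (point-<-next 0F s true) (ℕ.<-trans (point-<-next 1F true true) (point-<-next 2F true s′))
  point-< {1F} {2F} s s′ _ = point-<-next 1F s s′
  point-< {1F} {3F} s s′ _ = ℕ.<-trans (point-<-next 1F s true) (point-<-next 2F true s′)
  point-< {2F} {3F} s s′ _ = point-<-next 2F s s′
  point-< {1F}        {1F} _ _ (s≤s ())
  point-< {suc (suc _)} {1F} _ _ (s≤s ())
  point-< {suc (suc _)} {2F} _ _ (s≤s (s≤s ()))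
  point-< {3F}        {3F} _ _ (s≤s (s≤s (s≤s ())))

  point-rep : ∀ l → point (rep collapsed l) ≡ point l
  point-rep (j , false) with gap j
  ... | zero  = refl
  ... | suc _ = refl
  point-rep (j , true) with gap j | within j
  ... | zero  | eq = Fin.toℕ-injective (sym (trans eq (ℕ.+-identityʳ _)))
  ... | suc _ | _  = refl

  point-collapsed : ∀ j → gap j ≡ 0 → point (j , true) ≡ point (j , false)
  point-collapsed j gap≡0 =
    Fin.toℕ-injective (trans (within j) (trans (cong (λ g → toℕ (point (j , false)) + g) gap≡0) (ℕ.+-identityʳ _)))

  point-injective : ∀ l l′ → point l ≡ point l′ → rep collapsed l ≡ rep collapsed l′
  point-injective (j , s) (j′ , s′) eq with Fin.<-cmp j j′
  ... | tri< j<j′ _ _ = ⊥-elim (ℕ.<⇒≢ (point-< s s′ j<j′) (cong toℕ eq))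
  ... | tri> _ _ j′<j = ⊥-elim (ℕ.<⇒≢ (point-< s′ s j′<j) (cong toℕ (sym eq)))
  ... | tri≈ _ refl _ with gap j | within j
  ...   | zero  | _ = refl
  ...   | suc g | w = cong (j ,_) (sides s s′ eq)
    where
    false≢true : toℕ (point (j , false)) ≢ toℕ (point (j , true))
    false≢true e = ℕ.m≢1+m+n _ (trans e (trans w (ℕ.+-suc _ g)))
    sides : ∀ s s′ → point (j , s) ≡ point (j , s′) → s ≡ s′
    sides false false _ = refl
    sides true  true  _ = refl
    sides false true  e = ⊥-elim (false≢true (cong toℕ e))
    sides true  false e = ⊥-elim (false≢true (cong toℕ (sym e)))

  point-≢ : ∀ {j j′} s s′ → j ≢ j′ → point (j , s) ≢ point (j′ , s′)
  point-≢ s s′ j≢j′ eq = j≢j′ (cong proj₁ (point-injective (_ , s) (_ , s′) eq))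


δ-≡ : ∀ {x y} → x ≡ y → δ x y ≡ + 1
δ-≡ {x} {y} x≡y with x ℕ.≟ y
... | yes _   = refl
... | no x≢y  = ⊥-elim (x≢y x≡y)

δ-≢ : ∀ {x y} → x ≢ y → δ x y ≡ + 0
δ-≢ {x} {y} x≢y with x ℕ.≟ y
... | yes x≡y = ⊥-elim (x≢y x≡y)
... | no _    = refl

δ-suc : ∀ x y → δ (suc x) (suc y) ≡ δ x y
δ-suc x y with x ℕ.≟ y
... | yes x≡y = δ-≡ (cong suc x≡y)
... | no x≢y  = δ-≢ (x≢y ∘ ℕ.suc-injective)

δ-+ : ∀ a x y → δ (a + x) (a + y) ≡ δ x y
δ-+ zero    x y = refl
δ-+ (suc a) x y = trans (δ-suc (a + x) (a + y)) (δ-+ a x y)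

≢-toℕ : {x y : Fin n} → x ≢ y → toℕ x ≢ toℕ y
≢-toℕ x≢y = x≢y ∘ Fin.toℕ-injective

unitAt-δ : {g : Fin n → ℤ} {u : Fin n} → (∀ y → g y ≡ δ (toℕ y) (toℕ u)) → UnitAt g u
unitAt-δ g≡ = trans (g≡ _) (δ-≡ refl) , λ y y≢u → trans (g≡ y) (δ-≢ (≢-toℕ y≢u))

plusMinusPlus-δ : {g : Fin n → ℤ} {u v w : Fin n} → u ≢ v → v ≢ w → u ≢ w →
                  (∀ y → g y ≡ (δ (toℕ y) (toℕ u) ℤ.+ δ (toℕ y) (toℕ w)) ℤ.- δ (toℕ y) (toℕ v)) →
                  PlusMinusPlus g u v w
plusMinusPlus-δ {g = g} {u} {v} {w} u≢v v≢w u≢w g≡ = record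
  { at-u    = value u (δ-≡ refl) (δ-≢ (≢-toℕ u≢w)) (δ-≢ (≢-toℕ u≢v))
  ; at-v    = value v (δ-≢ (≢-toℕ (u≢v ∘ sym))) (δ-≢ (≢-toℕ v≢w)) (δ-≡ refl)
  ; at-w    = value w (δ-≢ (≢-toℕ (u≢w ∘ sym))) (δ-≡ refl) (δ-≢ (≢-toℕ (v≢w ∘ sym)))
  ; u≢w     = u≢w
  ; zero-at = λ y y≢u y≢v y≢w → value y (δ-≢ (≢-toℕ y≢u)) (δ-≢ (≢-toℕ y≢w)) (δ-≢ (≢-toℕ y≢v))
  }
  where
  value : ∀ y {a b c} → δ (toℕ y) (toℕ u) ≡ a → δ (toℕ y) (toℕ w) ≡ b → δ (toℕ y) (toℕ v) ≡ c →
          g y ≡ (a ℤ.+ b) ℤ.- c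
  value y refl refl refl = g≡ y

RowsUnit : Mat n → (ℕ → ℕ) → Set
RowsUnit X σ = ∀ r c → X r c ≡ δ (toℕ c) (σ (toℕ r))

ColsUnit : Mat n → (ℕ → ℕ) → Set
ColsUnit X τ = ∀ r c → X r c ≡ δ (toℕ r) (τ (toℕ c))

MapsBelow : ℕ → (ℕ → ℕ) → Set
MapsBelow k σ = ∀ r → r < k → σ r < k

-- Row r of C_k has its 1 in column r − 1 (mod k), column c has its 1 in row c + 1 (mod k).
cycleDown : ℕ → ℕ → ℕ
cycleDown k zero    = k ∸ 1
cycleDown k (suc r) = r

cycleUp : ℕ → ℕ → ℕ
cycleUp k c with suc c ℕ.≟ k
... | yes _ = 0
... | no _  = suc c

cycleDown-below : ∀ k → MapsBelow k (cycleDown k)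
cycleDown-below (suc k) zero    _   = ℕ.n<1+n k
cycleDown-below (suc k) (suc r) r<k = ℕ.<-trans (ℕ.n<1+n r) r<k

cycleUp-below : ∀ k → MapsBelow k (cycleUp k)
cycleUp-below k c c<k with suc c ℕ.≟ k
... | yes _     = ℕ.≤-<-trans z≤n c<k
... | no 1+c≢k  = ℕ.≤∧≢⇒< c<k 1+c≢k

cycleUp-last : ∀ k → cycleUp (suc k) k ≡ 0
cycleUp-last k with suc k ℕ.≟ suc k
... | yes _ = refl
... | no ne = ⊥-elim (ne refl)

Cyc-rowsUnit : ∀ k → RowsUnit (Cyc k) (cycleDown k)
Cyc-rowsUnit (suc k) r c with toℕ r ℕ.≟ suc (toℕ c)
... | yes r≡1+c rewrite r≡1+c = sym (δ-≡ refl)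
... | no r≢1+c = corner (toℕ r) r≢1+c
  where
  corner : ∀ x → x ≢ suc (toℕ c) → δ x 0 ℤ.* δ (suc (toℕ c)) (suc k) ≡ δ (toℕ c) (cycleDown (suc k) x)
  corner (suc x) x≢1+c = sym (δ-≢ (x≢1+c ∘ cong suc ∘ sym))
  corner zero    _ with suc (toℕ c) ℕ.≟ suc k
  ... | yes 1+c≡1+k = sym (δ-≡ (ℕ.suc-injective 1+c≡1+k))
  ... | no 1+c≢1+k  = sym (δ-≢ (1+c≢1+k ∘ cong suc))

Cyc-colsUnit : ∀ k → ColsUnit (Cyc k) (cycleUp k)
Cyc-colsUnit k r c with toℕ r ℕ.≟ suc (toℕ c) | suc (toℕ c) ℕ.≟ k
... | yes r≡1+c | yes 1+c≡k = ⊥-elim (ℕ.<-irrefl 1+c≡k (subst (_< k) r≡1+c (Fin.toℕ<n r)))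
... | yes r≡1+c | no _      = sym (δ-≡ r≡1+c)
... | no _      | yes 1+c≡k = trans (cong (δ (toℕ r) 0 ℤ.*_) (δ-≡ 1+c≡k)) (ℤ.*-identityʳ _)
... | no r≢1+c  | no 1+c≢k  =
  trans (cong (δ (toℕ r) 0 ℤ.*_) (δ-≢ 1+c≢k)) (trans (ℤ.*-zeroʳ (δ (toℕ r) 0)) (sym (δ-≢ r≢1+c)))

blockMap : ℕ → (ℕ → ℕ) → (ℕ → ℕ) → ℕ → ℕ
blockMap a σ₁ σ₂ r with r ℕ.<? a
... | yes _ = σ₁ r
... | no _  = a + σ₂ (r ∸ a)

module _ (a : ℕ) (σ₁ σ₂ : ℕ → ℕ) where
  blockMap-< : ∀ {r} → r < a → blockMap a σ₁ σ₂ r ≡ σ₁ r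
  blockMap-< {r} r<a with r ℕ.<? a
  ... | yes _   = refl
  ... | no r≮a  = ⊥-elim (r≮a r<a)

  blockMap-+ : ∀ r → blockMap a σ₁ σ₂ (a + r) ≡ a + σ₂ r
  blockMap-+ r with a + r ℕ.<? a
  ... | yes a+r<a = ⊥-elim (ℕ.m+n≮m a r a+r<a)
  ... | no _      = cong (λ x → a + σ₂ x) (ℕ.m+n∸m≡n a r)

  blockMap-below : ∀ {b} → MapsBelow a σ₁ → MapsBelow b σ₂ → MapsBelow (a + b) (blockMap a σ₁ σ₂)
  blockMap-below {b} σ₁< σ₂< r r<a+b with r ℕ.<? a
  ... | yes r<a = ℕ.<-≤-trans (σ₁< r r<a) (ℕ.m≤m+n a b)
  ... | no r≮a  = ℕ.+-monoʳ-< a (σ₂< (r ∸ a) (subst (r ∸ a <_) (ℕ.m+n∸m≡n a b) (ℕ.∸-monoˡ-< r<a+b (ℕ.≮⇒≥ r≮a))))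

module _ {a b : ℕ} where
  ⊕-rowsUnit : {X : Mat a} {Y : Mat b} {σ₁ σ₂ : ℕ → ℕ} → RowsUnit X σ₁ → RowsUnit Y σ₂ → MapsBelow a σ₁ →
               RowsUnit (X ⊕ Y) (blockMap a σ₁ σ₂)
  ⊕-rowsUnit {X} {Y} {σ₁} {σ₂} X≡ Y≡ σ₁< r c with Fin.splitAt a r in r≡ | Fin.splitAt a c in c≡
  ... | inj₁ r′ | inj₁ c′
    rewrite sym (Fin.splitAt⁻¹-↑ˡ r≡) | sym (Fin.splitAt⁻¹-↑ˡ c≡) | Fin.toℕ-↑ˡ r′ b | Fin.toℕ-↑ˡ c′ b
    = trans (X≡ r′ c′) (cong (δ (toℕ c′)) (sym (blockMap-< a σ₁ σ₂ (Fin.toℕ<n r′))))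
  ... | inj₂ r′ | inj₂ c′
    rewrite sym (Fin.splitAt⁻¹-↑ʳ r≡) | sym (Fin.splitAt⁻¹-↑ʳ c≡) | Fin.toℕ-↑ʳ a r′ | Fin.toℕ-↑ʳ a c′
    = trans (Y≡ r′ c′) (sym (trans (cong (δ (a + toℕ c′)) (blockMap-+ a σ₁ σ₂ (toℕ r′))) (δ-+ a _ _)))
  ... | inj₁ r′ | inj₂ c′
    rewrite sym (Fin.splitAt⁻¹-↑ˡ r≡) | sym (Fin.splitAt⁻¹-↑ʳ c≡) | Fin.toℕ-↑ˡ r′ b | Fin.toℕ-↑ʳ a c′
    = sym (trans (cong (δ (a + toℕ c′)) (blockMap-< a σ₁ σ₂ (Fin.toℕ<n r′)))
                 (δ-≢ (ℕ.>⇒≢ (ℕ.<-≤-trans (σ₁< _ (Fin.toℕ<n r′)) (ℕ.m≤m+n a _)))))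
  ... | inj₂ r′ | inj₁ c′
    rewrite sym (Fin.splitAt⁻¹-↑ʳ r≡) | sym (Fin.splitAt⁻¹-↑ˡ c≡) | Fin.toℕ-↑ʳ a r′ | Fin.toℕ-↑ˡ c′ b
    = sym (trans (cong (δ (toℕ c′)) (blockMap-+ a σ₁ σ₂ (toℕ r′)))
                 (δ-≢ (ℕ.<⇒≢ (ℕ.<-≤-trans (Fin.toℕ<n c′) (ℕ.m≤m+n a _)))))

  ⊕-transpose : (X : Mat a) (Y : Mat b) (r c : Fin (a + b)) → (X ⊕ Y) r c ≡ (transpose X ⊕ transpose Y) c r
  ⊕-transpose X Y r c with Fin.splitAt a r | Fin.splitAt a c
  ... | inj₁ _ | inj₁ _ = refl
  ... | inj₂ _ | inj₂ _ = refl
  ... | inj₁ _ | inj₂ _ = refl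
  ... | inj₂ _ | inj₁ _ = refl

  ⊕-colsUnit : {X : Mat a} {Y : Mat b} {τ₁ τ₂ : ℕ → ℕ} → ColsUnit X τ₁ → ColsUnit Y τ₂ → MapsBelow a τ₁ →
               ColsUnit (X ⊕ Y) (blockMap a τ₁ τ₂)
  ⊕-colsUnit {X} {Y} X≡ Y≡ τ₁< r c =
    trans (⊕-transpose X Y r c) (⊕-rowsUnit (λ r c → X≡ c r) (λ r c → Y≡ c r) τ₁< c r)

T-factor : ∀ N {a₁ b₁ a₂ b₂ A₁ B₁ A₂ B₂} → suc a₁ ≡ A₁ → suc b₁ ≡ B₁ → suc a₂ ≡ A₂ → suc b₂ ≡ B₂ →
           ∀ r c → T N A₁ B₁ A₂ B₂ r c ≡
                   (δ (toℕ r) a₁ ℤ.- δ (toℕ r) a₂) ℤ.* (δ (toℕ c) b₁ ℤ.- δ (toℕ c) b₂)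
T-factor N {a₁} {b₁} {a₂} {b₂} refl refl refl refl r c
  rewrite δ-suc (toℕ r) a₁ | δ-suc (toℕ r) a₂ | δ-suc (toℕ c) b₁ | δ-suc (toℕ c) b₂ =
  solve 4 (λ x y z w → ((x :* z :+ y :* w) :- x :* w) :- y :* z := (x :- y) :* (z :- w)) refl
          (δ (toℕ r) a₁) (δ (toℕ r) a₂) (δ (toℕ c) b₁) (δ (toℕ c) b₂)
  where open +-*-Solver

module _ (ch : Chain n) where
  open Chain ch

  cross : Mat n
  cross x y = (δ (toℕ x) (toℕ (point (0F , false))) ℤ.- δ (toℕ x) (toℕ (point (1F , false)))) ℤ.*
              (δ (toℕ y) (toℕ (point (2F , true))) ℤ.- δ (toℕ y) (toℕ (point (3F , true))))

  crossPattern : {A C : Mat n} {σ τ : ℕ → ℕ} → RowsUnit C σ → ColsUnit C τ → MapsBelow n σ → MapsBelow n τ →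
                 σ (toℕ (point (0F , false))) ≡ toℕ (point (1F , true)) →
                 σ (toℕ (point (1F , false))) ≡ toℕ (point (0F , true)) →
                 τ (toℕ (point (2F , true)))  ≡ toℕ (point (2F , false)) →
                 τ (toℕ (point (3F , true)))  ≡ toℕ (point (3F , false)) →
                 (∀ x y → A x y ≡ C x y ℤ.+ cross x y) → CrossPattern A
  crossPattern {A} {C} {σ} {τ} rowsC colsC σ< τ< σr₁ σr₂ τc₁ τc₂ A≡ = record
    { r₁ = r₁ ; r₂ = r₂ ; c₁ = c₁ ; c₂ = c₂ ; u₁ = u₁ ; u₂ = u₂ ; v₁ = v₁ ; v₂ = v₂
    ; row₁ = plusMinusPlus-δ (point-≢ _ _ λ ()) (point-≢ _ _ λ ()) (point-≢ _ _ λ ()) λ y →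
        trans (row-shape r₁ σr₁ (δ-≡ refl) (δ-≢ r₁≢r₂) y) (row₁-sum (e y u₁) (e y c₁) (e y c₂))
    ; row₂ = plusMinusPlus-δ (point-≢ _ _ λ ()) (point-≢ _ _ λ ()) (point-≢ _ _ λ ()) λ y →
        trans (row-shape r₂ σr₂ (δ-≢ (r₁≢r₂ ∘ sym)) (δ-≡ refl) y) (row₂-sum (e y u₂) (e y c₁) (e y c₂))
    ; col₁ = plusMinusPlus-δ (point-≢ _ _ λ ()) (point-≢ _ _ λ ()) (point-≢ _ _ λ ()) λ x →
        trans (col-shape c₁ τc₁ (δ-≡ refl) (δ-≢ c₁≢c₂) x) (col₁-sum (e x v₁) (e x r₁) (e x r₂))
    ; col₂ = plusMinusPlus-δ (point-≢ _ _ λ ()) (point-≢ _ _ λ ()) (point-≢ _ _ λ ()) λ x →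
        trans (col-shape c₂ τc₂ (δ-≢ (c₁≢c₂ ∘ sym)) (δ-≡ refl) x) (col₂-sum (e x v₂) (e x r₁) (e x r₂))
    ; otherRow = λ x x≢r₁ x≢r₂ → _ , unitAt-δ λ y →
        trans (row-shape x (sym (Fin.toℕ-fromℕ< (σ< _ (Fin.toℕ<n x)))) (δ-≢ (≢-toℕ x≢r₁)) (δ-≢ (≢-toℕ x≢r₂)) y)
              (row-sum (e y _) (e y c₁ ℤ.- e y c₂))
    ; otherCol = λ y y≢c₁ y≢c₂ → _ , unitAt-δ λ x →
        trans (col-shape y (sym (Fin.toℕ-fromℕ< (τ< _ (Fin.toℕ<n y)))) (δ-≢ (≢-toℕ y≢c₁)) (δ-≢ (≢-toℕ y≢c₂)) x)
              (col-sum (e x _) (e x r₁ ℤ.- e x r₂))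
    }
    where
    r₁ u₂ r₂ u₁ v₁ c₁ v₂ c₂ : Fin n
    r₁ = point (0F , false)
    u₂ = point (0F , true)
    r₂ = point (1F , false)
    u₁ = point (1F , true)
    v₁ = point (2F , false)
    c₁ = point (2F , true)
    v₂ = point (3F , false)
    c₂ = point (3F , true)

    e : Fin n → Fin n → ℤ
    e x y = δ (toℕ x) (toℕ y)

    r₁≢r₂ : toℕ r₁ ≢ toℕ r₂
    r₁≢r₂ = ≢-toℕ (point-≢ _ _ λ ())
    c₁≢c₂ : toℕ c₁ ≢ toℕ c₂
    c₁≢c₂ = ≢-toℕ (point-≢ _ _ λ ())

    row-shape : ∀ x {u a b} → σ (toℕ x) ≡ toℕ u → e x r₁ ≡ a → e x r₂ ≡ b →
                ∀ y → A x y ≡ e y u ℤ.+ (a ℤ.- b) ℤ.* (e y c₁ ℤ.- e y c₂)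
    row-shape x σx refl refl y = trans (A≡ x y) (cong (ℤ._+ cross x y) (trans (rowsC x y) (cong (δ (toℕ y)) σx)))

    col-shape : ∀ y {v a b} → τ (toℕ y) ≡ toℕ v → e y c₁ ≡ a → e y c₂ ≡ b →
                ∀ x → A x y ≡ e x v ℤ.+ (e x r₁ ℤ.- e x r₂) ℤ.* (a ℤ.- b)
    col-shape y τy refl refl x = trans (A≡ x y) (cong (ℤ._+ cross x y) (trans (colsC x y) (cong (δ (toℕ x)) τy)))

    open +-*-Solver
    row₁-sum : ∀ x a b → x ℤ.+ (+ 1 ℤ.- + 0) ℤ.* (a ℤ.- b) ≡ (x ℤ.+ a) ℤ.- b
    row₁-sum = solve 3 (λ x a b → x :+ (con (+ 1) :- con (+ 0)) :* (a :- b) := (x :+ a) :- b) refl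
    row₂-sum : ∀ x a b → x ℤ.+ (+ 0 ℤ.- + 1) ℤ.* (a ℤ.- b) ≡ (x ℤ.+ b) ℤ.- a
    row₂-sum = solve 3 (λ x a b → x :+ (con (+ 0) :- con (+ 1)) :* (a :- b) := (x :+ b) :- a) refl
    row-sum : ∀ x f → x ℤ.+ (+ 0 ℤ.- + 0) ℤ.* f ≡ x
    row-sum = solve 2 (λ x f → x :+ (con (+ 0) :- con (+ 0)) :* f := x) refl
    col₁-sum : ∀ x a b → x ℤ.+ (a ℤ.- b) ℤ.* (+ 1 ℤ.- + 0) ≡ (a ℤ.+ x) ℤ.- b
    col₁-sum = solve 3 (λ x a b → x :+ (a :- b) :* (con (+ 1) :- con (+ 0)) := (a :+ x) :- b) refl
    col₂-sum : ∀ x a b → x ℤ.+ (a ℤ.- b) ℤ.* (+ 0 ℤ.- + 1) ≡ (b ℤ.+ x) ℤ.- a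
    col₂-sum = solve 3 (λ x a b → x :+ (a :- b) :* (con (+ 0) :- con (+ 1)) := (b :+ x) :- a) refl
    col-sum : ∀ x f → x ℤ.+ f ℤ.* (+ 0 ℤ.- + 0) ≡ x
    col-sum = solve 2 (λ x f → x :+ f :* (con (+ 0) :- con (+ 0)) := x) refl


_≟-Label_ : (k l : Label) → Dec (k ≡ l)
_≟-Label_ = Product.≡-dec Fin._≟_ Bool._≟_

-- When no label of the class of l occurs in ks, the junk value is the length of ks.
classIndex : (Fin 4 → Bool) → List Label → Label → ℕ
classIndex z []       l = 0
classIndex z (k ∷ ks) l with rep z k ≟-Label rep z l
... | yes _ = 0
... | no _  = suc (classIndex z ks l)

ValidOrder : (Fin 4 → Bool) → List Label → Set
ValidOrder z ks =
  AllPairs (λ k l → rep z k ≢ rep z l) ks ×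
  (∀ l → Any (λ k → rep z k ≡ rep z l) ks) ×
  Monotone₄ (P (1F , true)) (P (3F , true)) (P (2F , true)) (P (0F , true)) ×
  Monotone₄ (P (2F , false)) (P (1F , false)) (P (0F , false)) (P (3F , false))
  where
  P : Label → ℕ
  P = classIndex z ks

monotone₄? : ∀ a b c d → Dec (Monotone₄ a b c d)
monotone₄? a b c d = (a ℕ.<? b ×-dec b ℕ.<? c ×-dec c ℕ.<? d) ⊎-dec (d ℕ.<? c ×-dec c ℕ.<? b ×-dec b ℕ.<? a)

∀-Label? : {P : Label → Set} → (∀ l → Dec (P l)) → Dec (∀ l → P l)
∀-Label? {P} P? = map′ (λ h → uncurry h) (λ h j s → h (j , s)) (Fin.all? λ j → ∀-Bool? j)
  where
  both : ∀ {j} → P (j , false) × P (j , true) → ∀ s → P (j , s)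
  both (f , _) false = f
  both (_ , t) true  = t
  ∀-Bool? : ∀ j → Dec (∀ s → P (j , s))
  ∀-Bool? j = map′ both (λ h → h false , h true) (P? (j , false) ×-dec P? (j , true))

validOrder? : ∀ z ks → Dec (ValidOrder z ks)
validOrder? z ks =
  AllPairs.allPairs? (λ k l → ¬? (rep z k ≟-Label rep z l)) ks ×-dec
  ∀-Label? (λ l → any? (λ k → rep z k ≟-Label rep z l) ks) ×-dec
  monotone₄? _ _ _ _ ×-dec monotone₄? _ _ _ _

monotone₄-cong : ∀ {a b c d a′ b′ c′ d′} → a ≡ a′ → b ≡ b′ → c ≡ c′ → d ≡ d′ →
                 Monotone₄ a b c d → Monotone₄ a′ b′ c′ d′
monotone₄-cong refl refl refl refl m = m

module _ (ch : Chain n) where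
  open Chain ch

  -- Arranged (crossPattern ch …) π unfolds to ChainArranged π.
  ChainArranged : Permutation′ n → Set
  ChainArranged π =
    Monotone₄ (ρ (1F , true)) (ρ (3F , true)) (ρ (2F , true)) (ρ (0F , true)) ×
    Monotone₄ (ρ (2F , false)) (ρ (1F , false)) (ρ (0F , false)) (ρ (3F , false))
    where
    ρ : Label → ℕ
    ρ l = toℕ (π ⟨$⟩ˡ point l)

  placed-classIndex : ∀ {π k} ks l → PlacedFrom k π (map point ks) →
                      Any (λ k′ → rep collapsed k′ ≡ rep collapsed l) ks →
                      toℕ (π ⟨$⟩ˡ point l) ≡ k + classIndex collapsed ks l
  placed-classIndex {π} (k′ ∷ ks) l (ρk′ , placed) covered with rep collapsed k′ ≟-Label rep collapsed l
  ... | yes same = trans (cong (toℕ ∘ (π ⟨$⟩ˡ_)) same-point) (trans ρk′ (sym (ℕ.+-identityʳ _)))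
    where
    same-point : point l ≡ point k′
    same-point = trans (sym (point-rep l)) (trans (cong point (sym same)) (point-rep k′))
  ... | no differ with covered
  ...   | here same     = ⊥-elim (differ same)
  ...   | there covered′ = trans (placed-classIndex ks l placed covered′) (sym (ℕ.+-suc _ _))

  realise : ∀ ks → ValidOrder collapsed ks → ∃ ChainArranged
  realise ks (apart , covers , cols , rows) with enumerate (map point ks) distinct
    where
    distinct : AllPairs _≢_ (map point ks)
    distinct = AllPairs.map⁺ (AllPairs.map (λ {k} {l} r≢ → r≢ ∘ point-injective k l) apart)
  ... | π , placed = π , monotone₄-cong (position _) (position _) (position _) (position _) cols ,
                         monotone₄-cong (position _) (position _) (position _) (position _) rows
    where
    position : ∀ l → classIndex collapsed ks l ≡ toℕ (π ⟨$⟩ˡ point l)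
    position l = sym (placed-classIndex ks l placed (covers l))

  ThreeCollapsed : Set
  ThreeCollapsed = (gap 0F ≡ 0 × gap 1F ≡ 0 × gap 2F ≡ 0) ⊎ (gap 0F ≡ 0 × gap 1F ≡ 0 × gap 3F ≡ 0) ⊎
                   (gap 1F ≡ 0 × gap 2F ≡ 0 × gap 3F ≡ 0) ⊎ (gap 0F ≡ 0 × gap 2F ≡ 0 × gap 3F ≡ 0)

  private
    ρ≡ : (π : Permutation′ n) {j : Fin 4} → gap j ≡ 0 →
         toℕ (π ⟨$⟩ˡ point (j , false)) ≡ toℕ (π ⟨$⟩ˡ point (j , true))
    ρ≡ π {j} g = cong (toℕ ∘ (π ⟨$⟩ˡ_)) (sym (point-collapsed j g))

  threeCollapsed-¬arranged : ThreeCollapsed → ∀ π → ¬ ChainArranged π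
  threeCollapsed-¬arranged (inj₁ (g₀ , g₁ , g₂)) π (cols , rows) =
    ¬monotone₄-012 cols (monotone₄-cong (ρ≡ π g₂) (ρ≡ π g₁) (ρ≡ π g₀) refl rows)
  threeCollapsed-¬arranged (inj₂ (inj₁ (g₀ , g₁ , g₃))) π (cols , rows) =
    ¬monotone₄-013 cols (monotone₄-cong refl (ρ≡ π g₁) (ρ≡ π g₀) (ρ≡ π g₃) rows)
  threeCollapsed-¬arranged (inj₂ (inj₂ (inj₁ (g₁ , g₂ , g₃)))) π (cols , rows) =
    ¬monotone₄-123 cols (monotone₄-cong (ρ≡ π g₂) (ρ≡ π g₁) refl (ρ≡ π g₃) rows)
  threeCollapsed-¬arranged (inj₂ (inj₂ (inj₂ (g₀ , g₂ , g₃)))) π (cols , rows) =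
    ¬monotone₄-023 cols (monotone₄-cong (ρ≡ π g₂) refl (ρ≡ π g₀) (ρ≡ π g₃) rows)


-- The matrix of the theorem

-- With p = 2 + I + J, i = 2 + I, q = 1 + Q and m = 1 + M, the blocks of the chain are the
-- 0-based indices of (row 1, column i − 1), (row i, column p), (row p + 1, column p + q) and
-- (row p + q + 1, column n); their gaps I, J, Q, M vanish exactly when i = 2, i = p, q = 1, m = 1.
module AmatByGaps (I J Q M : ℕ) where
  p q m : ℕ
  p = suc (suc (I + J))
  q = suc Q
  m = suc M

  coord : Label → ℕ
  coord (0F , false) = 0
  coord (0F , true)  = I
  coord (1F , false) = suc I
  coord (1F , true)  = suc (I + J)
  coord (2F , false) = p
  coord (2F , true)  = p + Q
  coord (3F , false) = p + q
  coord (3F , true)  = p + q + M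

  gaps : Fin 4 → ℕ
  gaps 0F = I
  gaps 1F = J
  gaps 2F = Q
  gaps 3F = M

  private
    ≤₇ : p + q ≤ p + q + M
    ≤₇ = ℕ.m≤m+n (p + q) M
    ≤₆ : p + Q ≤ p + q + M
    ≤₆ = ℕ.≤-trans (ℕ.+-monoʳ-≤ p (ℕ.n≤1+n Q)) ≤₇
    ≤₅ : p ≤ p + q + M
    ≤₅ = ℕ.≤-trans (ℕ.m≤m+n p Q) ≤₆
    ≤₄ : suc (I + J) ≤ p + q + M
    ≤₄ = ℕ.≤-trans (ℕ.n≤1+n (suc (I + J))) ≤₅
    ≤₃ : suc I ≤ p + q + M
    ≤₃ = ℕ.≤-trans (s≤s (ℕ.m≤m+n I J)) ≤₄
    ≤₂ : I ≤ p + q + M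
    ≤₂ = ℕ.≤-trans (ℕ.n≤1+n I) ≤₃

  coord≤last : ∀ l → coord l ≤ p + q + M
  coord≤last (0F , false) = z≤n
  coord≤last (0F , true)  = ≤₂
  coord≤last (1F , false) = ≤₃
  coord≤last (1F , true)  = ≤₄
  coord≤last (2F , false) = ≤₅
  coord≤last (2F , true)  = ≤₆
  coord≤last (3F , false) = ≤₇
  coord≤last (3F , true)  = ℕ.≤-refl

  coord< : ∀ l → coord l < p + q + m
  coord< l = ℕ.≤-<-trans (coord≤last l) (ℕ.+-monoʳ-< (p + q) (ℕ.n<1+n M))

  point : Label → Fin (p + q + m)
  point l = fromℕ< (coord< l)

  toℕ-point : ∀ l → toℕ (point l) ≡ coord l
  toℕ-point l = Fin.toℕ-fromℕ< (coord< l)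

  chain : Chain (p + q + m)
  chain = record { point = point ; gap = gaps ; within = within ; across = across }
    where
    coord-within : ∀ j → coord (j , true) ≡ coord (j , false) + gaps j
    coord-within 0F = refl
    coord-within 1F = refl
    coord-within 2F = refl
    coord-within 3F = refl
    within : ∀ j → toℕ (point (j , true)) ≡ toℕ (point (j , false)) + gaps j
    within j =
      trans (toℕ-point (j , true)) (trans (coord-within j) (cong (ℕ._+ gaps j) (sym (toℕ-point (j , false)))))
    coord-across : ∀ j → coord (Fin.inject₁ j , true) < coord (suc j , false)
    coord-across 0F = ℕ.n<1+n I
    coord-across 1F = ℕ.n<1+n (suc (I + J))
    coord-across 2F = ℕ.+-monoʳ-< p (ℕ.n<1+n Q)
    across : ∀ j → toℕ (point (Fin.inject₁ j , true)) < toℕ (point (suc j , false))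
    across j =
      subst₂ _<_ (sym (toℕ-point (Fin.inject₁ j , true))) (sym (toℕ-point (suc j , false))) (coord-across j)

  σ₁ τ₁ σ τ : ℕ → ℕ
  σ₁ = blockMap p (cycleDown p) (cycleDown q)
  τ₁ = blockMap p (cycleUp p) (cycleUp q)
  σ = blockMap (p + q) σ₁ (cycleDown m)
  τ = blockMap (p + q) τ₁ (cycleUp m)

  C : Mat (p + q + m)
  C = Cyc p ⊕ Cyc q ⊕ Cyc m

  C-rowsUnit : RowsUnit C σ
  C-rowsUnit = ⊕-rowsUnit (⊕-rowsUnit (Cyc-rowsUnit p) (Cyc-rowsUnit q) (cycleDown-below p)) (Cyc-rowsUnit m)
                          (blockMap-below p _ _ (cycleDown-below p) (cycleDown-below q))

  C-colsUnit : ColsUnit C τ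
  C-colsUnit = ⊕-colsUnit (⊕-colsUnit (Cyc-colsUnit p) (Cyc-colsUnit q) (cycleUp-below p)) (Cyc-colsUnit m)
                          (blockMap-below p _ _ (cycleUp-below p) (cycleUp-below q))

  σ-below : MapsBelow (p + q + m) σ
  σ-below = blockMap-below (p + q) _ _ (blockMap-below p _ _ (cycleDown-below p) (cycleDown-below q))
                           (cycleDown-below m)

  τ-below : MapsBelow (p + q + m) τ
  τ-below = blockMap-below (p + q) _ _ (blockMap-below p _ _ (cycleUp-below p) (cycleUp-below q))
                           (cycleUp-below m)

  private
    at-point : ∀ (f : ℕ → ℕ) l l′ → f (coord l) ≡ coord l′ → f (toℕ (point l)) ≡ toℕ (point l′)
    at-point f l l′ eq = trans (cong f (toℕ-point l)) (trans eq (sym (toℕ-point l′)))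

    p<p+q : p < p + q
    p<p+q = ℕ.m<m+n p (s≤s z≤n)

    σ-row₁ : σ 0 ≡ suc (I + J)
    σ-row₁ = trans (blockMap-< (p + q) σ₁ (cycleDown m) (ℕ.<-trans (s≤s z≤n) p<p+q))
                   (blockMap-< p (cycleDown p) (cycleDown q) (s≤s z≤n))

    σ-row₂ : σ (suc I) ≡ I
    σ-row₂ = trans (blockMap-< (p + q) σ₁ (cycleDown m) (ℕ.<-trans 1+I<p p<p+q))
                   (blockMap-< p (cycleDown p) (cycleDown q) 1+I<p)
      where
      1+I<p : suc I < p
      1+I<p = s≤s (s≤s (ℕ.m≤m+n I J))

    τ-col₁ : τ (p + Q) ≡ p
    τ-col₁ = begin
      τ (p + Q)       ≡⟨ blockMap-< (p + q) τ₁ (cycleUp m) (ℕ.+-monoʳ-< p (ℕ.n<1+n Q)) ⟩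
      τ₁ (p + Q)      ≡⟨ blockMap-+ p (cycleUp p) (cycleUp q) Q ⟩
      p + cycleUp q Q ≡⟨ cong (ℕ._+_ p) (cycleUp-last Q) ⟩
      p + 0           ≡⟨ ℕ.+-identityʳ p ⟩
      p               ∎
      where open ≡-Reasoning

    τ-col₂ : τ (p + q + M) ≡ p + q
    τ-col₂ = trans (blockMap-+ (p + q) τ₁ (cycleUp m) M)
                   (trans (cong (ℕ._+_ (p + q)) (cycleUp-last M)) (ℕ.+-identityʳ _))

  A≡C+cross : ∀ x y → Amat p q m (suc (suc I)) x y ≡ C x y ℤ.+ cross chain x y
  A≡C+cross x y =
    cong (ℤ._+_ (C x y))
         (trans (T-factor (p + q + m) refl (sym (ℕ.+-suc p Q)) refl (sym (ℕ.+-suc (p + q) M)) x y) cross-coord)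
    where
    cross-coord : (δ (toℕ x) 0 ℤ.- δ (toℕ x) (suc I)) ℤ.* (δ (toℕ y) (p + Q) ℤ.- δ (toℕ y) (p + q + M)) ≡
                  cross chain x y
    cross-coord
      rewrite toℕ-point (0F , false) | toℕ-point (1F , false) | toℕ-point (2F , true) | toℕ-point (3F , true)
      = refl

  crossPattern-Amat : CrossPattern (Amat p q m (suc (suc I)))
  crossPattern-Amat = crossPattern chain C-rowsUnit C-colsUnit σ-below τ-below
    (at-point σ (0F , false) (1F , true) σ-row₁) (at-point σ (1F , false) (0F , true) σ-row₂)
    (at-point τ (2F , true) (2F , false) τ-col₁) (at-point τ (3F , true) (3F , false) τ-col₂) A≡C+cross

  private
    2+-injective : ∀ {x y} → suc (suc x) ≡ suc (suc y) → x ≡ y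
    2+-injective = ℕ.suc-injective ∘ ℕ.suc-injective

  exceptional⇒threeCollapsed : Exceptional p q m (suc (suc I)) → ThreeCollapsed chain
  exceptional⇒threeCollapsed (inj₁ (p≡2 , _ , inj₁ q≡1)) =
    inj₁ (ℕ.m+n≡0⇒m≡0 I (2+-injective p≡2) , ℕ.m+n≡0⇒n≡0 I (2+-injective p≡2) , ℕ.suc-injective q≡1)
  exceptional⇒threeCollapsed (inj₁ (p≡2 , _ , inj₂ m≡1)) =
    inj₂ (inj₁ (ℕ.m+n≡0⇒m≡0 I (2+-injective p≡2) , ℕ.m+n≡0⇒n≡0 I (2+-injective p≡2) , ℕ.suc-injective m≡1))
  exceptional⇒threeCollapsed (inj₂ (inj₁ (i≡p , q≡1 , m≡1))) =
    inj₂ (inj₂ (inj₁ (J≡0 , ℕ.suc-injective q≡1 , ℕ.suc-injective m≡1)))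
    where
    J≡0 : J ≡ 0
    J≡0 = sym (ℕ.+-cancelˡ-≡ I 0 J (trans (ℕ.+-identityʳ I) (2+-injective i≡p)))
  exceptional⇒threeCollapsed (inj₂ (inj₂ (i≡2 , q≡1 , m≡1))) =
    inj₂ (inj₂ (inj₂ (2+-injective i≡2 , ℕ.suc-injective q≡1 , ℕ.suc-injective m≡1)))

open AmatByGaps using (chain; crossPattern-Amat; exceptional⇒threeCollapsed)

decidedValidOrder : ∀ I J Q M ks → {True (validOrder? (Chain.collapsed (chain I J Q M)) ks)} →
                    ∃ (ValidOrder (Chain.collapsed (chain I J Q M)))
decidedValidOrder I J Q M ks {valid} = ks , toWitness valid

-- One order for each of the eleven unexceptional patterns of vanishing gaps, verified by evaluation.
validOrder : ∀ I J Q M → ¬ Exceptional (suc (suc (I + J))) (suc Q) (suc M) (suc (suc I)) →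
             ∃ (ValidOrder (Chain.collapsed (chain I J Q M)))
validOrder I@(suc _) J@(suc _) Q@(suc _) M@(suc _) _ = decidedValidOrder I J Q M
  ((0F , true) ∷ (2F , false) ∷ (1F , false) ∷ (0F , false) ∷ (2F , true) ∷ (3F , false) ∷ (3F , true) ∷
   (1F , true) ∷ [])
validOrder I@(suc _) J@(suc _) Q@(suc _) M@zero   _ = decidedValidOrder I J Q M
  ((0F , true) ∷ (2F , false) ∷ (1F , false) ∷ (0F , false) ∷ (2F , true) ∷ (3F , false) ∷ (1F , true) ∷ [])
validOrder I@(suc _) J@(suc _) Q@zero   M@(suc _) _ = decidedValidOrder I J Q M
  ((0F , true) ∷ (2F , false) ∷ (1F , false) ∷ (0F , false) ∷ (3F , false) ∷ (3F , true) ∷ (1F , true) ∷ [])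
validOrder I@(suc _) J@(suc _) Q@zero   M@zero   _ = decidedValidOrder I J Q M
  ((0F , true) ∷ (2F , false) ∷ (1F , false) ∷ (0F , false) ∷ (3F , false) ∷ (1F , true) ∷ [])
validOrder I@(suc _) J@zero   Q@(suc _) M@(suc _) _ = decidedValidOrder I J Q M
  ((0F , true) ∷ (2F , false) ∷ (2F , true) ∷ (3F , true) ∷ (1F , false) ∷ (0F , false) ∷ (3F , false) ∷ [])
validOrder I@(suc _) J@zero   Q@(suc _) M@zero   _ = decidedValidOrder I J Q M
  ((0F , true) ∷ (2F , true) ∷ (3F , false) ∷ (0F , false) ∷ (1F , false) ∷ (2F , false) ∷ [])
validOrder I@(suc _) J@zero   Q@zero   M@(suc _) _ = decidedValidOrder I J Q M
  ((0F , true) ∷ (2F , false) ∷ (3F , true) ∷ (1F , false) ∷ (0F , false) ∷ (3F , false) ∷ [])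
validOrder I@zero   J@(suc _) Q@(suc _) M@(suc _) _ = decidedValidOrder I J Q M
  ((1F , true) ∷ (2F , false) ∷ (1F , false) ∷ (3F , true) ∷ (2F , true) ∷ (0F , false) ∷ (3F , false) ∷ [])
validOrder I@zero   J@(suc _) Q@(suc _) M@zero   _ = decidedValidOrder I J Q M
  ((1F , true) ∷ (3F , false) ∷ (2F , true) ∷ (0F , false) ∷ (1F , false) ∷ (2F , false) ∷ [])
validOrder I@zero   J@(suc _) Q@zero   M@(suc _) _ = decidedValidOrder I J Q M
  ((1F , true) ∷ (3F , true) ∷ (2F , false) ∷ (1F , false) ∷ (0F , false) ∷ (3F , false) ∷ [])
validOrder I@zero   J@zero   Q@(suc _) M@(suc _) _ = decidedValidOrder I J Q M
  ((2F , false) ∷ (1F , false) ∷ (3F , true) ∷ (2F , true) ∷ (0F , false) ∷ (3F , false) ∷ [])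
validOrder zero    zero    zero    _       ¬exc = ⊥-elim (¬exc (inj₁ (refl , refl , inj₁ refl)))
validOrder zero    zero    (suc _) zero    ¬exc = ⊥-elim (¬exc (inj₁ (refl , refl , inj₂ refl)))
validOrder (suc I) zero    zero    zero    ¬exc =
  ⊥-elim (¬exc (inj₂ (inj₁ (cong (λ k → ℕ.suc (ℕ.suc k)) (sym (ℕ.+-identityʳ (suc I))) , refl , refl))))
validOrder zero    (suc _) zero    zero    ¬exc = ⊥-elim (¬exc (inj₂ (inj₂ (refl , refl , refl))))

theorem5p5 : (p q m i : ℕ) → 2 ≤ p → 1 ≤ q → 1 ≤ m → 1 < i → i ≤ p →
    (¬ Exceptional p q m i → PermSimilarToASM (Amat p q m i)) ×
    (Exceptional p q m i → ¬ PermSimilarToASM (Amat p q m i))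
theorem5p5 p zero    m       i             _ () _ _ _
theorem5p5 p (suc Q) zero    i             _ _ () _ _
theorem5p5 p (suc Q) (suc M) zero          _ _ _ () _
theorem5p5 p (suc Q) (suc M) (suc zero)    _ _ _ (s≤s ()) _
theorem5p5 p (suc Q) (suc M) (suc (suc I)) _ _ _ _ i≤p with ℕ.m≤n⇒∃[o]m+o≡n i≤p
... | J , refl =
  (λ ¬exc → Equivalence.from asm⇔arranged (realise (chain I J Q M) _ (proj₂ (validOrder I J Q M ¬exc)))) ,
  (λ exc asm → let π , arranged = Equivalence.to asm⇔arranged asm in
     threeCollapsed-¬arranged (chain I J Q M) (exceptional⇒threeCollapsed I J Q M exc) π arranged)
  where
  asm⇔arranged : PermSimilarToASM (Amat (suc (suc (I + J))) (suc Q) (suc M) (suc (suc I))) ⇔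
                 ∃ (Arranged (crossPattern-Amat I J Q M))
  asm⇔arranged = permSimilarToASM⇔arranged (crossPattern-Amat I J Q M)
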